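{- There exist a finite lookup table $\mathcal{F}$ and graph machines $\mathcal{M}_e$ ($e\in\mathbb{N}$), defined uniformly in $e$, all with lookup table $\mathcal{F}$, with underlying graph $\mathcal{G}_e$ on vertex set $\mathbb{N}$ and edge coloring $E_e$, with the following property. Let $e\in\mathbb{N}$ be such that $\{e\}$ is a total function $\mathbb{N}\to\{0,1\}$ and $m_e=\lim_{n\to\infty}\{e\}(n)$ exists. Then: (i) $\mathcal{G}_e$ has only finitely many edges (pairs $(v,w)$ with $E_e(v,w)\neq\emptyset$), and each vertex of $\mathcal{G}_e$ has degree at most $3$; (ii) let $f$ be a valid configuration of $\mathcal{M}_e$ in which every vertex is in the initial state; if vertex $0$ displays $0$ under $f$, then the run $\langle\mathcal{M}_e,f\rangle$ halts with every vertex displaying $0$, and if vertex $0$ displays $1$ under $f$, then the run halts with vertex $0$ displaying $m_e$ (and every other vertex displaying $0$); (iii) for $k\in\mathbb{N}$, if $|\{n:\{e\}(n)\neq\{e\}(n+1)\}|<k$, then $\mathcal{M}_e$ halts on any starting configuration within at most $2k+4$ timesteps.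
   Context: Notation. $\{e\}$ denotes the $e$-th partial computable function in a fixed standard enumeration. $\mathfrak{P}_{<\omega}(Y)$ denotes the set of finite subsets of $Y$. For a tuple-valued function $f$, $f_{[k]}$ denotes its $k$-th coordinate. Colored graphs. A colored graph is $\mathcal{G}=(G,(L,V),(C,E),\gamma)$ with vertex set $G$, label set $L$, labeling $V\colon G\to L$, color set $C$, edge coloring $E\colon G\times G\to\mathfrak{P}_{<\omega}(C)$, and $\gamma\colon L\to\mathfrak{P}_{<\omega}(C)$ with $E(v,w)\subseteq\gamma(V(v))\cap\gamma(V(w))$. The degree of $v$ is $|\{w: E(v,w)\cup E(w,v)\neq\emptyset\}|$. Graph machines. A graph machine is $\mathfrak{M}=(\mathcal{G},(\mathfrak{A},\{0,1\}),(S,s,\alpha),T)$ with: - a finite alphabet $\mathfrak{A}\ni0,1$; - a countable state set $S$; - a state assignment $\alpha\colon L\to\mathfrak{P}_{<\omega}(S)$; - an initial state $s\in\alpha(\ell)$ for all $\ell$; - a lookup table $T\colon L\times\mathfrak{P}_{<\omega}(C)\times\mathfrak{A}\times S\to\mathfrak{P}_{<\omega}(C)\times\mathfrak{A}\times S$. The lookup table satisfies three conditions: - $T(\ell,c,z,t)=(c,z,t)$ if $c\not\subseteq\gamma(\ell)$ or $t\notin\alpha(\ell)$; - when $c\subseteq\gamma(\ell)$ and $t\in\alpha(\ell)$, $T_{[1]}(\ell,c,z,t)\subseteq\gamma(\ell)$ and $T_{[3]}(\ell,c,z,t)\in\alpha(\ell)$; - $T(\ell,\emptyset,0,s)=(\emptyset,0,s)$.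 Configurations. A valid configuration is $f\colon G\to\mathfrak{P}_{<\omega}(C)\times\mathfrak{A}\times S$ with $f_{[1]}(v)\subseteq\gamma(V(v))$ and $f_{[3]}(v)\in\alpha(V(v))$. Vertex $v$ displays $f_{[2]}(v)$ and is in state $f_{[3]}(v)$. A starting configuration is one with $f_{[1]}(v)=\emptyset$ and $f_{[3]}(v)=s$ for all $v$, and $f_{[2]}(v)\neq0$ for only finitely many $v$. Runs. The run is given by $\langle\mathfrak{M},f\rangle(v,0)=f(v)$ and $\langle\mathfrak{M},f\rangle(v,n+1)=T(V(v),X,z,t)$, where $z,t$ are the 2nd and 3rd coordinates at stage $n$ and $X=\bigcup_w(E(w,v)\cap\langle\mathfrak{M},f\rangle_{[1]}(w,n))$. It halts at stage $n$ if the stage-$n$ and stage-$(n+1)$ configurations coincide; "halts with" a property means the configuration at the halting stage has that property. -}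

module Defs where

open import Data.Nat using (ℕ; zero; suc; _+_; _*_; _≤_; _<_; _≟_)
open import Data.Fin using (Fin; zero; suc)
open import Data.Fin.Subset using (Subset; _∈_; _⊆_; _∩_; _∪_) renaming (⊥ to ∅)
open import Data.Product using (Σ; _×_; _,_; proj₁; proj₂)
open import Data.Sum using (_⊎_)
open import Data.List using (List; []; _∷_; length)
open import Data.List.Relation.Unary.All using (All)
open import Data.List.Relation.Unary.Unique.Propositional using (Unique)
open import Data.Maybe using (Maybe; just; nothing)
open import Relation.Binary.PropositionalEquality using (_≡_; _≢_)
open import Relation.Nullary using (¬_; yes; no)

-- A fixed standard enumeration {e} of the partial computable functions:
-- counter (register) machines with unboundedly many registers, indexed
-- by a surjective coding ℕ → programs.

data Instr : Set where
  inc : ℕ → Instr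
  dec : ℕ → ℕ → Instr

Program : Set
Program = List Instr

record RMConfig : Set where
  constructor ⟨_,_⟩
  field
    pc  : ℕ
    reg : ℕ → ℕ
open RMConfig public

update : (ℕ → ℕ) → ℕ → ℕ → (ℕ → ℕ)
update f r x i with i ≟ r
... | yes _ = x
... | no  _ = f i

lookupInstr : Program → ℕ → Maybe Instr
lookupInstr []       _       = nothing
lookupInstr (i ∷ p)  zero    = just i
lookupInstr (i ∷ p)  (suc n) = lookupInstr p n

step : Program → RMConfig → RMConfig
step p c with lookupInstr p (pc c)
... | nothing = c
... | just (inc r) = ⟨ suc (pc c) , update (reg c) r (suc (reg c r)) ⟩
... | just (dec r k) with reg c r
...   | zero  = ⟨ k , reg c ⟩
...   | suc x = ⟨ suc (pc c) , update (reg c) r x ⟩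

exec : Program → ℕ → RMConfig → RMConfig
exec p zero    c = c
exec p (suc t) c = exec p t (step p c)

RMHalted : Program → RMConfig → Set
RMHalted p c = lookupInstr p (pc c) ≡ nothing

-- input in register 0, all other registers 0, output read from register 0
initRM : ℕ → RMConfig
initRM n = ⟨ 0 , (λ { zero → n ; (suc _) → 0 }) ⟩

nextPair : ℕ × ℕ → ℕ × ℕ
nextPair (x , zero)  = (0 , suc x)
nextPair (x , suc y) = (suc x , y)

unpair : ℕ → ℕ × ℕ
unpair zero    = (0 , 0)
unpair (suc n) = nextPair (unpair n)

decodeInstr : ℕ → Instr
decodeInstr n with unpair n
... | (zero , r)  = inc r
... | (suc _ , b) = dec (proj₁ (unpair b)) (proj₂ (unpair b))

decodeProgF : ℕ → ℕ → Program
decodeProgF zero     _       = []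
decodeProgF (suc f)  zero    = []
decodeProgF (suc f)  (suc n) = decodeInstr (proj₁ (unpair n)) ∷ decodeProgF f (proj₂ (unpair n))

prog : ℕ → Program
prog e = decodeProgF e e

Φ⟨_⟩_↓_ : ℕ → ℕ → ℕ → Set
Φ⟨ e ⟩ n ↓ y = Σ ℕ λ t → RMHalted (prog e) (exec (prog e) t (initRM n))
                        × reg (exec (prog e) t (initRM n)) 0 ≡ y

Total01 : ℕ → Set
Total01 e = ∀ n → Σ ℕ λ y → (Φ⟨ e ⟩ n ↓ y) × y ≤ 1

LimitIs : ℕ → ℕ → Set
LimitIs e m = Σ ℕ λ N → ∀ n → N ≤ n → Φ⟨ e ⟩ n ↓ m

ChangePoint : ℕ → ℕ → Set
ChangePoint e n = Σ ℕ λ y → Σ ℕ λ y' → (Φ⟨ e ⟩ n ↓ y) × (Φ⟨ e ⟩ suc n ↓ y') × y ≢ y'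

FewerChangesThan : ℕ → ℕ → Set
FewerChangesThan e k = ∀ (ns : List ℕ) → Unique ns → All (ChangePoint e) ns → length ns < k

-- Graph machines with finite label/color/alphabet/state sets
-- L = Fin nL, C = Fin nC, 𝔄 = Fin (2 + a) (0 ↦ zero, 1 ↦ suc zero), S = Fin nS,
-- P_{<ω}(C) = Subset nC.  Vertex set is ℕ.

Alph : ℕ → Set
Alph a = Fin (2 + a)

𝟘 : ∀ {a} → Alph a
𝟘 = zero

𝟙 : ∀ {a} → Alph a
𝟙 = suc zero

bitSym : ∀ {a} → ℕ → Alph a
bitSym zero    = 𝟘
bitSym (suc _) = 𝟙

Cell : ℕ → ℕ → ℕ → Set
Cell nC a nS = Subset nC × Alph a × Fin nS

cols : ∀ {nC a nS} → Cell nC a nS → Subset nC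
cols x = proj₁ x

disp : ∀ {nC a nS} → Cell nC a nS → Alph a
disp x = proj₁ (proj₂ x)

state : ∀ {nC a nS} → Cell nC a nS → Fin nS
state x = proj₂ (proj₂ x)

Table : ℕ → ℕ → ℕ → ℕ → Set
Table nL nC a nS = Fin nL → Subset nC → Alph a → Fin nS → Cell nC a nS

record GM (nL nC nS : ℕ) : Set where
  field
    V : ℕ → Fin nL
    E : ℕ → ℕ → Subset nC
    γ : Fin nL → Subset nC
    α : Fin nL → Subset nS
    s : Fin nS
open GM public

record IsGraphMachine {nL nC a nS} (M : GM nL nC nS) (T : Table nL nC a nS) : Set where
  field
    edge-ok : ∀ v w → E M v w ⊆ γ M (V M v) ∩ γ M (V M w)
    init-ok : ∀ ℓ → s M ∈ α M ℓ
    T-out   : ∀ ℓ c z t → (¬ (c ⊆ γ M ℓ) ⊎ ¬ (t ∈ α M ℓ)) → T ℓ c z t ≡ (c , z , t)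
    T-in    : ∀ ℓ c z t → c ⊆ γ M ℓ → t ∈ α M ℓ →
                (cols (T ℓ c z t) ⊆ γ M ℓ) × (state (T ℓ c z t) ∈ α M ℓ)
    T-idle  : ∀ ℓ → T ℓ ∅ 𝟘 (s M) ≡ (∅ , 𝟘 , s M)

Config : ℕ → ℕ → ℕ → Set
Config nC a nS = ℕ → Cell nC a nS

Valid : ∀ {nL nC a nS} → GM nL nC nS → Config nC a nS → Set
Valid M f = ∀ v → (cols (f v) ⊆ γ M (V M v)) × (state (f v) ∈ α M (V M v))

Starting : ∀ {nL nC a nS} → GM nL nC nS → Config nC a nS → Set
Starting M f = (∀ v → cols (f v) ≡ ∅ × state (f v) ≡ s M)
             × Σ ℕ λ B → ∀ v → B ≤ v → disp (f v) ≡ 𝟘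

-- r v n = ⟨M,f⟩(v,n); X is the (finite) union over all w of E(w,v) ∩ ⟨M,f⟩_[1](w,n),
-- characterised by its membership
IsRun : ∀ {nL nC a nS} → GM nL nC nS → Table nL nC a nS → Config nC a nS
      → (ℕ → ℕ → Cell nC a nS) → Set
IsRun {nC = nC} M T f r =
    (∀ v → r v 0 ≡ f v)
  × (∀ v n → Σ (Subset nC) λ X →
        (∀ c → (c ∈ X → Σ ℕ λ w → c ∈ E M w v × c ∈ cols (r w n))
             × ((Σ ℕ λ w → c ∈ E M w v × c ∈ cols (r w n)) → c ∈ X))
      × r v (suc n) ≡ T (V M v) X (disp (r v n)) (state (r v n)))

HaltsAt : ∀ {nC a nS} → (ℕ → ℕ → Cell nC a nS) → ℕ → Set
HaltsAt r n = ∀ v → r v n ≡ r v (suc n)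

FinitelyManyEdges : ∀ {nL nC nS} → GM nL nC nS → Set
FinitelyManyEdges M = Σ ℕ λ B → ∀ v w → E M v w ≢ ∅ → v < B × w < B

DegreeAtMost3 : ∀ {nL nC nS} → GM nL nC nS → Set
DegreeAtMost3 M = ∀ v (ws : List ℕ) → Unique ws →
                  All (λ w → (E M v w ∪ E M w v) ≢ ∅) ws → length ws ≤ 3

{-# OPTIONS --safe #-}
-- The guess for lim {e} at stage t is {e}(j) for the largest j ≤ t whose computation halts
-- within t steps.  Vertex t + 1 of 𝓜_e lies on a chain headed by the root 0 exactly when the
-- guess changes at stage t, and it is labelled by the new guess; vertices off the chain have
-- no edges.  A root started with 1 sends a query down the chain, one edge per step; the last
-- chain vertex, whose guess is the limit m, answers, and the answer travels back, so after
-- 2K + 1 steps (K the number of non-root chain vertices) the root displays m and nothing moves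
-- any more.  A root started with 0 never sends anything.  Every change of guess after the
-- first passes from an index j to a larger index with a different value, hence over a change
-- point of {e} not passed before; so K ≤ 1 + (number of change points) ≤ k.

module Submission where

open import Defs
open import Data.Nat using (ℕ; zero; suc; _+_; _*_; _≤_; _<_; z≤n; s≤s; _≟_; _≤?_)
open import Data.Nat.Properties
open import Data.Bool using (Bool; true; false; if_then_else_)
open import Data.Bool.Properties using () renaming (_≟_ to _≟ᵇ_)
open import Data.Maybe using (Maybe; just; nothing; fromMaybe; maybe′)
import Data.Maybe as Maybe
open import Data.Maybe.Properties using (≡-dec)
open import Data.Product using (Σ; ∃; _×_; _,_; proj₁; proj₂; map₁)
open import Data.Sum using (_⊎_; inj₁; inj₂)
open import Data.Unit using (⊤; tt)
open import Data.Fin using (Fin; zero; suc)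
open import Data.Fin.Subset using (Subset; _∈_; _∉_; ⁅_⁆; ∁; _∪_) renaming (⊥ to ∅)
import Data.Fin.Subset as Subset
open import Data.Fin.Subset.Properties using (∈⊤; ⊆⊤; ∉⊥; x∈⁅x⁆; x∈⁅y⁆⇒x≡y; x∈p⇒x∉∁p; x∉p⇒x∈∁p)
open import Data.Vec using (lookup)
open import Data.Vec.Properties using ([]=⇒lookup; lookup⇒[]=)
open import Data.List using (List; []; _∷_; length)
open import Data.List.Relation.Unary.All as All using (All; []; _∷_)
open import Data.List.Relation.Unary.AllPairs using ([]; _∷_)
open import Data.List.Relation.Unary.Unique.Propositional using (Unique)
open import Relation.Binary.Definitions using (DecidableEquality; tri<; tri≈; tri>)
open import Relation.Binary.PropositionalEquality
open import Relation.Nullary using (¬_; Dec; yes; no; contradiction)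
open import Relation.Nullary.Decidable using (isNo; _×-dec_)

-- Bounded evaluation of {e}

exec-+ : ∀ p m n c → exec p (m + n) c ≡ exec p n (exec p m c)
exec-+ p zero    n c = refl
exec-+ p (suc m) n c = exec-+ p m n (step p c)

step-halted : ∀ p c → RMHalted p c → step p c ≡ c
step-halted p c halted with lookupInstr p (pc c)
... | nothing = refl

exec-halted : ∀ p n c → RMHalted p c → exec p n c ≡ c
exec-halted p zero    c halted = refl
exec-halted p (suc n) c halted rewrite step-halted p c halted = exec-halted p n c halted

exec-stable : ∀ p {m n} c → m ≤ n → RMHalted p (exec p m c) → exec p n c ≡ exec p m c
exec-stable p {m} c m≤n halted with m≤n⇒∃[o]m+o≡n m≤n
... | o , refl = trans (exec-+ p m o c) (exec-halted p o _ halted)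

Φ-deterministic : ∀ {e n y y′} → Φ⟨ e ⟩ n ↓ y → Φ⟨ e ⟩ n ↓ y′ → y ≡ y′
Φ-deterministic {e} {n} (t , halted , refl) (t′ , halted′ , refl) with ≤-total t t′
... | inj₁ t≤t′ = cong (λ c → reg c 0) (sym (exec-stable (prog e) (initRM n) t≤t′ halted))
... | inj₂ t′≤t = cong (λ c → reg c 0) (exec-stable (prog e) (initRM n) t′≤t halted′)

output : Program → RMConfig → Maybe ℕ
output p c with lookupInstr p (pc c)
... | nothing = just (reg c 0)
... | just _  = nothing

output-just : ∀ p c {y} → output p c ≡ just y → RMHalted p c × reg c 0 ≡ y
output-just p c eq with lookupInstr p (pc c)
output-just p c refl | nothing = refl , refl

output-halted : ∀ p c → RMHalted p c → output p c ≡ just (reg c 0)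
output-halted p c halted with lookupInstr p (pc c)
... | nothing = refl

evalWithin : ℕ → ℕ → ℕ → Maybe ℕ
evalWithin e n t = output (prog e) (exec (prog e) t (initRM n))

evalWithin-sound : ∀ e n t {y} → evalWithin e n t ≡ just y → Φ⟨ e ⟩ n ↓ y
evalWithin-sound e n t eq = t , output-just (prog e) _ eq

evalWithin-complete : ∀ {e n y t} ((t₀ , _ , _) : Φ⟨ e ⟩ n ↓ y) → t₀ ≤ t → evalWithin e n t ≡ just y
evalWithin-complete {e} {n} (t₀ , halted , refl) t₀≤t
  rewrite exec-stable (prog e) (initRM n) t₀≤t halted = output-halted (prog e) _ halted

evalWithin-mono : ∀ e n {t t′ y} → evalWithin e n t ≡ just y → t ≤ t′ → evalWithin e n t′ ≡ just y
evalWithin-mono e n {t} eq t≤t′ = evalWithin-complete (evalWithin-sound e n t eq) t≤t′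

module Changes {A : Set} (_≟ᴬ_ : DecidableEquality A) (a : ℕ → A) where

  changesAt : ℕ → Bool
  changesAt t = isNo (a (suc t) ≟ᴬ a t)

  changesAt-true : ∀ {t} → changesAt t ≡ true → a (suc t) ≢ a t
  changesAt-true {t} h with a (suc t) ≟ᴬ a t
  ... | no a≢ = a≢

  changesAt-false : ∀ {t} → changesAt t ≡ false → a (suc t) ≡ a t
  changesAt-false {t} h with a (suc t) ≟ᴬ a t
  ... | yes a≡ = a≡

  ≢⇒changesAt : ∀ {t} → a (suc t) ≢ a t → changesAt t ≡ true
  ≢⇒changesAt {t} a≢ with a (suc t) ≟ᴬ a t
  ... | yes a≡ = contradiction a≡ a≢
  ... | no _   = refl

  ≡⇒¬changesAt : ∀ {t} → a (suc t) ≡ a t → changesAt t ≡ false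
  ≡⇒¬changesAt {t} a≡ with a (suc t) ≟ᴬ a t
  ... | yes _  = refl
  ... | no a≢  = contradiction a≡ a≢

  constant-after : ∀ {n} → (∀ t → n ≤ t → changesAt t ≡ false) → ∀ t → n ≤ t → a t ≡ a n
  constant-after {n} quiet t n≤t with m≤n⇒m<n∨m≡n n≤t
  ... | inj₂ refl = refl
  constant-after {n} quiet (suc t) _ | inj₁ (s≤s n≤t) =
    trans (changesAt-false (quiet t n≤t)) (constant-after quiet t n≤t)

  eventually-constant⇒quiet : ∀ {n x} → (∀ t → n ≤ t → a t ≡ x) → ∀ t → n ≤ t → changesAt t ≡ false
  eventually-constant⇒quiet eventually t n≤t =
    ≡⇒¬changesAt (trans (eventually (suc t) (m≤n⇒m≤1+n n≤t)) (sym (eventually t n≤t)))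

  some-change : ∀ n → a 0 ≢ a n → ∃ λ t → changesAt t ≡ true
  some-change zero    a≢ = contradiction refl a≢
  some-change (suc n) a≢ with a (suc n) ≟ᴬ a n
  ... | yes a≡ = some-change n (λ eq → a≢ (trans eq (sym a≡)))
  ... | no a≢′ = n , ≢⇒changesAt a≢′

-- Stage guesses for lim {e}

latest : ℕ → ℕ → ℕ → Maybe (ℕ × ℕ)
latest e t zero with evalWithin e 0 t
... | just y  = just (0 , y)
... | nothing = nothing
latest e t (suc n) with evalWithin e (suc n) t
... | just y  = just (suc n , y)
... | nothing = latest e t n

latest-sound : ∀ e t n {j y} → latest e t n ≡ just (j , y) → j ≤ n × evalWithin e j t ≡ just y
latest-sound e t zero    eq with evalWithin e 0 t in ev
latest-sound e t zero    refl | just _ = z≤n , ev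
latest-sound e t (suc n) eq with evalWithin e (suc n) t in ev
latest-sound e t (suc n) refl | just _ = ≤-refl , ev
... | nothing = map₁ m≤n⇒m≤1+n (latest-sound e t n eq)

latest-maximal : ∀ e t n {j y} → evalWithin e j t ≡ just y → j ≤ n →
                 ∃ λ j′ → ∃ λ y′ → latest e t n ≡ just (j′ , y′) × j ≤ j′
latest-maximal e t zero    ev z≤n with evalWithin e 0 t
... | just y′ = 0 , y′ , refl , z≤n
latest-maximal e t (suc n) ev j≤ with evalWithin e (suc n) t in ev′
... | just y′ = suc n , y′ , refl , j≤
... | nothing with m≤n⇒m<n∨m≡n j≤
...   | inj₁ (s≤s j≤n) = latest-maximal e t n ev j≤n
...   | inj₂ refl      = contradiction (trans (sym ev′) ev) λ ()

latest-step : ∀ e t {j y} → latest e t t ≡ just (j , y) →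
              ∃ λ j′ → ∃ λ y′ → latest e (suc t) (suc t) ≡ just (j′ , y′) × j ≤ j′
latest-step e t eq with latest-sound e t t eq
... | j≤t , ev = latest-maximal e (suc t) (suc t) (evalWithin-mono e _ ev (n≤1+n t)) (m≤n⇒m≤1+n j≤t)

-- approx e (t + 1) is the stage-t guess; approx e 0 = nothing, so the first guess counts as a change.
approx : ℕ → ℕ → Maybe ℕ
approx e zero    = nothing
approx e (suc t) = Maybe.map proj₂ (latest e t t)

changed : ℕ → ℕ → Bool
changed e = Changes.changesAt (≡-dec _≟_) (approx e)

approx-eventually : ∀ {e m} → LimitIs e m → ∃ λ S → ∀ t → S ≤ t → approx e t ≡ just m
approx-eventually {e} {m} (N , limit) = suc (N + t₀) , from
  where
  t₀ : ℕ
  t₀ = proj₁ (limit N ≤-refl)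

  from : ∀ t → suc (N + t₀) ≤ t → approx e t ≡ just m
  from (suc t) (s≤s N+t₀≤t)
    with latest-maximal e t t (evalWithin-complete (limit N ≤-refl) (≤-trans (m≤n+m t₀ N) N+t₀≤t))
                              (≤-trans (m≤m+n N t₀) N+t₀≤t)
  ... | j , y , eq , N≤j = trans (cong (Maybe.map proj₂) eq)
    (cong just (Φ-deterministic (evalWithin-sound e j t (proj₂ (latest-sound e t t eq))) (limit j N≤j)))

approx-changes : ∀ {e y} → Φ⟨ e ⟩ 0 ↓ y → ∃ λ t → changed e t ≡ true
approx-changes {e} φ@(t₀ , _) with latest-maximal e t₀ t₀ (evalWithin-complete φ ≤-refl) z≤n
... | _ , _ , eq , _ =
  Changes.some-change (≡-dec _≟_) (approx e) (suc t₀) λ eq′ →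
    contradiction (trans eq′ (cong (Maybe.map proj₂) eq)) λ ()

-- Labels: root, or node b for a vertex whose guess is b.  Colour 0 is the query, sent forward
-- along the chain; colour 1 + b carries the answer b backwards.  Only the root ever waits.
pattern root    = zero
pattern node σ  = suc σ
pattern idle    = zero
pattern waiting = suc zero
pattern query   = zero

silent : Cell 3 0 2
silent = (∅ , 𝟘 , idle)

asking : Alph 0 → Cell 3 0 2
asking z = (⁅ query ⁆ , z , waiting)

relaying : Alph 0 → Cell 3 0 2
relaying β = (⁅ query ⁆ ∪ ⁅ suc β ⁆ , 𝟘 , idle)

asked : Subset 3 → Bool
asked X = lookup X query

answer : Bool → Bool → Maybe (Alph 0)
answer _     true  = just 𝟙
answer true  false = just 𝟘
answer false false = nothing

answerIn : Subset 3 → Maybe (Alph 0)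
answerIn X = answer (lookup X (suc 𝟘)) (lookup X (suc 𝟙))

answerIn-relaying : ∀ β → answerIn (cols (relaying β)) ≡ just β
answerIn-relaying zero       = refl
answerIn-relaying (suc zero) = refl

respond : Alph 0 → Subset 3 → Cell 3 0 2
respond σ X = if asked X then relaying (fromMaybe σ (answerIn X)) else silent

respond-asked : ∀ {σ X} → asked X ≡ true → respond σ X ≡ relaying (fromMaybe σ (answerIn X))
respond-asked eq rewrite eq = refl

respond-unasked : ∀ {σ X} → asked X ≡ false → respond σ X ≡ silent
respond-unasked eq rewrite eq = refl

table : Table 3 3 0 2
table root     X z       waiting = asking (fromMaybe z (answerIn X))
table root     X zero    idle    = silent
table root     X (suc _) idle    = asking 𝟙
table (node σ) X _       _       = respond σ X

∈⇔∈⇒lookup≡ : ∀ {n} {X Y : Subset n} {i} → (i ∈ X → i ∈ Y) → (i ∈ Y → i ∈ X) →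
               lookup X i ≡ lookup Y i
∈⇔∈⇒lookup≡ {X = X} {Y} {i} to from with lookup X i in x | lookup Y i in y
... | true  | true  = refl
... | false | false = refl
... | true  | false = contradiction (trans (sym ([]=⇒lookup (to (lookup⇒[]= i X x)))) y) λ ()
... | false | true  = contradiction (trans (sym ([]=⇒lookup (from (lookup⇒[]= i Y y)))) x) λ ()

module RunOf {nL nC a nS} {M : GM nL nC nS} {T : Table nL nC a nS} {f r} (run : IsRun M T f r) where

  incoming : ℕ → ℕ → Subset nC
  incoming v n = proj₁ (proj₂ run v n)

  run-start : ∀ v → r v 0 ≡ f v
  run-start = proj₁ run

  run-step : ∀ v n → r v (suc n) ≡ T (V M v) (incoming v n) (disp (r v n)) (state (r v n))
  run-step v n = proj₂ (proj₂ (proj₂ run v n))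

  incoming-spec : ∀ v n c → (c ∈ incoming v n → ∃ λ w → c ∈ E M w v × c ∈ cols (r w n))
                          × ((∃ λ w → c ∈ E M w v × c ∈ cols (r w n)) → c ∈ incoming v n)
  incoming-spec v n = proj₁ (proj₂ (proj₂ run v n))

  incoming-from : ∀ {v n c w} → c ∈ E M w v → (∀ {w′} → c ∈ E M w′ v → w′ ≡ w) →
                  lookup (incoming v n) c ≡ lookup (cols (r w n)) c
  incoming-from {v} {n} {c} {w} edge sole =
    ∈⇔∈⇒lookup≡ to (λ c∈ → proj₂ (incoming-spec v n c) (w , edge , c∈))
    where
    to : c ∈ incoming v n → c ∈ cols (r w n)
    to c∈ with proj₁ (incoming-spec v n c) c∈
    ... | w′ , edge′ , c∈′ rewrite sole edge′ = c∈′

  incoming-none : ∀ {v n c} → (∀ w → c ∉ E M w v) → lookup (incoming v n) c ≡ false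
  incoming-none {v} {n} {c} none with lookup (incoming v n) c in eq
  ... | false = refl
  ... | true with proj₁ (incoming-spec v n c) (lookup⇒[]= c _ eq)
  ...   | w , edge , _ = contradiction edge (none w)

eventually-constant⇒HaltsAt : ∀ {nC a nS} {r : ℕ → ℕ → Cell nC a nS} {g : ℕ → Cell nC a nS} {N} →
                              (∀ n → N ≤ n → ∀ v → r v (suc n) ≡ g v) → HaltsAt r (suc N)
eventually-constant⇒HaltsAt settles v = trans (settles _ ≤-refl v) (sym (settles _ (n≤1+n _) v))

-- The chain machine

unique-length≤2 : ∀ {A : Set} {P Q : A → Set} →
                  (∀ {x y} → P x → P y → x ≡ y) → (∀ {x y} → Q x → Q y → x ≡ y) →
                  ∀ {xs} → Unique xs → All (λ x → P x ⊎ Q x) xs → length xs ≤ 2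
unique-length≤2 P-sole Q-sole {[]}          _ _ = z≤n
unique-length≤2 P-sole Q-sole {_ ∷ []}      _ _ = s≤s z≤n
unique-length≤2 P-sole Q-sole {_ ∷ _ ∷ []}  _ _ = s≤s (s≤s z≤n)
unique-length≤2 P-sole Q-sole {_ ∷ _ ∷ _ ∷ _} ((x≢y ∷ x≢z ∷ _) ∷ (y≢z ∷ _) ∷ _) (px ∷ py ∷ pz ∷ _)
  with px | py | pz
... | inj₁ p | inj₁ p′ | _       = contradiction (P-sole p p′) x≢y
... | inj₂ q | inj₂ q′ | _       = contradiction (Q-sole q q′) x≢y
... | inj₁ p | inj₂ _  | inj₁ p′ = contradiction (P-sole p p′) x≢z
... | inj₂ q | inj₁ _  | inj₂ q′ = contradiction (Q-sole q q′) x≢z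
... | inj₁ _ | inj₂ q  | inj₂ q′ = contradiction (Q-sole q q′) y≢z
... | inj₂ _ | inj₁ p  | inj₁ p′ = contradiction (P-sole p p′) y≢z

module Chain (c : ℕ → Bool) where

  OnChain : ℕ → Set
  OnChain zero    = ⊤
  OnChain (suc t) = c t ≡ true

  onChain? : ∀ v → Dec (OnChain v)
  onChain? zero    = yes tt
  onChain? (suc t) = c t ≟ᵇ true

  depth : ℕ → ℕ
  depth zero    = 0
  depth (suc t) = if c t then suc (depth t) else depth t

  -- Chain vertices have pairwise distinct depths, so this says that v follows u on the chain.
  IsNext : ℕ → ℕ → Set
  IsNext u v = OnChain u × OnChain v × depth v ≡ suc (depth u)

  isNext? : ∀ u v → Dec (IsNext u v)
  isNext? u v = onChain? u ×-dec onChain? v ×-dec (depth v ≟ suc (depth u))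

  depth-on : ∀ {t} → c t ≡ true → depth (suc t) ≡ suc (depth t)
  depth-on on rewrite on = refl

  positive-depth : ∀ {t} → c t ≡ true → 0 < depth (suc t)
  positive-depth on = subst (0 <_) (sym (depth-on on)) (s≤s z≤n)

  depth-off : ∀ {t} → c t ≡ false → depth (suc t) ≡ depth t
  depth-off off rewrite off = refl

  depth-suc-≤ : ∀ {t n} → depth t ≤ n → (c t ≡ true → depth t < n) → depth (suc t) ≤ n
  depth-suc-≤ {t} ≤n <n with c t
  ... | true  = <n refl
  ... | false = ≤n

  depth-≤-suc : ∀ t → depth t ≤ depth (suc t)
  depth-≤-suc t with c t
  ... | true  = n≤1+n _
  ... | false = ≤-refl

  depth-mono : ∀ {u v} → u ≤ v → depth u ≤ depth v
  depth-mono {v = zero}  z≤n = ≤-refl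
  depth-mono {v = suc t} u≤v with m≤n⇒m<n∨m≡n u≤v
  ... | inj₁ (s≤s u≤t) = ≤-trans (depth-mono u≤t) (depth-≤-suc t)
  ... | inj₂ refl      = ≤-refl

  depth-strict : ∀ {u v} → OnChain v → u < v → depth u < depth v
  depth-strict {v = suc t} on (s≤s u≤t) = ≤-trans (s≤s (depth-mono u≤t)) (≤-reflexive (sym (depth-on on)))

  depth-injective : ∀ {u v} → OnChain u → OnChain v → depth u ≡ depth v → u ≡ v
  depth-injective {u} {v} onU onV eq with <-cmp u v
  ... | tri< u<v _ _ = contradiction eq (<⇒≢ (depth-strict onV u<v))
  ... | tri≈ _ u≡v _ = u≡v
  ... | tri> _ _ v<u = contradiction eq (>⇒≢ (depth-strict onU v<u))

  next-unique : ∀ {u w w′} → IsNext u w → IsNext u w′ → w ≡ w′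
  next-unique (_ , onW , eq) (_ , onW′ , eq′) = depth-injective onW onW′ (trans eq (sym eq′))

  previous-unique : ∀ {u u′ v} → IsNext u v → IsNext u′ v → u ≡ u′
  previous-unique (onU , _ , eq) (onU′ , _ , eq′) = depth-injective onU onU′ (suc-injective (trans (sym eq) eq′))

  vertex-at-depth : ∀ n {d} → d ≤ depth n → ∃ λ u → OnChain u × depth u ≡ d
  vertex-at-depth zero    z≤n = 0 , tt , refl
  vertex-at-depth (suc t) d≤ with c t in on
  ... | false = vertex-at-depth t d≤
  ... | true with m≤n⇒m<n∨m≡n d≤
  ...   | inj₁ (s≤s d≤t) = vertex-at-depth t d≤t
  ...   | inj₂ refl      = suc t , on , depth-on on

  predecessor : ∀ {t} → c t ≡ true → ∃ λ u → IsNext u (suc t)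
  predecessor {t} on with vertex-at-depth t ≤-refl
  ... | u , onU , eq = u , onU , on , trans (depth-on on) (cong suc (sym eq))

  next-asymmetric : ∀ {u v} → IsNext u v → ¬ IsNext v u
  next-asymmetric (_ , _ , eq) (_ , _ , eq′) = <-asym (≤-reflexive (sym eq)) (≤-reflexive (sym eq′))

  edges : ℕ → ℕ → Subset 3
  edges u v with isNext? u v | isNext? v u
  ... | yes _ | _     = ⁅ query ⁆
  ... | no _  | yes _ = ∁ ⁅ query ⁆
  ... | no _  | no _  = ∅

  labelling : (ℕ → Alph 0) → ℕ → Fin 3
  labelling σ zero    = root
  labelling σ (suc t) = node (σ t)

  machine : (ℕ → Alph 0) → GM 3 3 2
  machine σ = record
    { V = labelling σ ; E = edges ; γ = λ _ → Subset.⊤ ; α = λ _ → Subset.⊤ ; s = idle }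

  machine-isGraphMachine : ∀ σ → IsGraphMachine (machine σ) table
  machine-isGraphMachine σ = record
    { edge-ok = λ _ _ _ → ∈⊤
    ; init-ok = λ _ → ∈⊤
    ; T-out   = λ { _ _ _ _ (inj₁ c⊈) → contradiction (λ {x} → ⊆⊤ {x = x}) c⊈
                  ; _ _ _ _ (inj₂ t∉) → contradiction ∈⊤ t∉ }
    ; T-in    = λ _ _ _ _ _ _ → ⊆⊤ , ∈⊤
    ; T-idle  = λ { root → refl ; (node _) → refl }
    }

  query-edge : ∀ {u v} → query ∈ edges u v → IsNext u v
  query-edge {u} {v} q∈ with isNext? u v | isNext? v u
  ... | yes next | _     = next
  ... | no _     | yes _ = contradiction q∈ (x∈p⇒x∉∁p (x∈⁅x⁆ query))
  ... | no _     | no _  = contradiction q∈ ∉⊥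

  next⇒query-edge : ∀ {u v} → IsNext u v → query ∈ edges u v
  next⇒query-edge {u} {v} next with isNext? u v
  ... | yes _     = x∈⁅x⁆ query
  ... | no ¬next  = contradiction next ¬next

  answer-edge : ∀ {w v i} → suc i ∈ edges w v → IsNext v w
  answer-edge {w} {v} i∈ with isNext? w v | isNext? v w
  ... | yes _ | _        = contradiction (x∈⁅y⁆⇒x≡y query i∈) λ ()
  ... | no _  | yes next = next
  ... | no _  | no _     = contradiction i∈ ∉⊥

  next⇒answer-edge : ∀ {w v i} → IsNext v w → suc i ∈ edges w v
  next⇒answer-edge {w} {v} next with isNext? w v | isNext? v w
  ... | yes next′ | _       = contradiction next′ (next-asymmetric next)
  ... | no _      | yes _   = x∉p⇒x∈∁p λ i∈ → contradiction (x∈⁅y⁆⇒x≡y query i∈) λ ()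
  ... | no _      | no ¬next = contradiction next ¬next

  adjacent : ∀ {u v} → edges u v ≢ ∅ → IsNext u v ⊎ IsNext v u
  adjacent {u} {v} nonempty with isNext? u v | isNext? v u
  ... | yes next | _        = inj₁ next
  ... | no _     | yes next = inj₂ next
  ... | no _     | no _     = contradiction refl nonempty

  neighbour : ∀ {u v} → edges u v ∪ edges v u ≢ ∅ → IsNext u v ⊎ IsNext v u
  neighbour {u} {v} nonempty with isNext? u v | isNext? v u
  ... | yes next | _        = inj₁ next
  ... | no _     | yes next = inj₂ next
  ... | no _     | no _     = contradiction refl nonempty

  degree≤3 : ∀ σ → DegreeAtMost3 (machine σ)
  degree≤3 σ v ws unique neighbours =
    ≤-trans (unique-length≤2 next-unique previous-unique unique (All.map neighbour neighbours)) (n≤1+n 2)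

  module Settled {B} (settled : ∀ t → B ≤ t → c t ≡ false) where

    chainLength : ℕ
    chainLength = depth B

    depth-settled : ∀ {v} → B ≤ v → depth v ≡ chainLength
    depth-settled {zero}  z≤n = refl
    depth-settled {suc t} B≤v with m≤n⇒m<n∨m≡n B≤v
    ... | inj₁ (s≤s B≤t) = trans (depth-off (settled t B≤t)) (depth-settled B≤t)
    ... | inj₂ refl      = refl

    depth≤chainLength : ∀ v → depth v ≤ chainLength
    depth≤chainLength v with ≤-total v B
    ... | inj₁ v≤B = depth-mono v≤B
    ... | inj₂ B≤v = ≤-reflexive (depth-settled B≤v)

    onChain⇒≤ : ∀ {v} → OnChain v → v ≤ B
    onChain⇒≤ {zero}  _  = z≤n
    onChain⇒≤ {suc t} on with B ≤? t
    ... | yes B≤t = contradiction (trans (sym on) (settled t B≤t)) λ ()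
    ... | no  B≰t = ≰⇒> B≰t

    successor : ∀ {u} → OnChain u → depth u < chainLength → ∃ λ w → IsNext u w
    successor onU d< with vertex-at-depth B d<
    ... | w , onW , eq = w , onU , onW , eq

    last-has-no-next : ∀ {u w} → depth u ≡ chainLength → ¬ IsNext u w
    last-has-no-next {w = w} eq (_ , _ , eqW) =
      1+n≰n (subst (_≤ chainLength) (trans eqW (cong suc eq)) (depth≤chainLength w))

    quiet-after-last : ∀ {v} → OnChain v → depth v ≡ chainLength → ∀ t → v ≤ t → c t ≡ false
    quiet-after-last {v} onV eq t v≤t with c t in on
    ... | false = refl
    ... | true  = contradiction (depth≤chainLength (suc t)) (<⇒≱ (begin-strict
      chainLength     ≡⟨ sym eq ⟩
      depth v         ≤⟨ depth-mono v≤t ⟩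
      depth t         <⟨ n<1+n _ ⟩
      suc (depth t)   ≡⟨ sym (depth-on on) ⟩
      depth (suc t)   ∎))
      where open ≤-Reasoning

    positive-length : ∀ {t} → c t ≡ true → 0 < chainLength
    positive-length {t} on = <-≤-trans (positive-depth on) (depth≤chainLength (suc t))

    finitely-many-edges : ∀ σ → FinitelyManyEdges (machine σ)
    finitely-many-edges σ = suc B , bounded
      where
      bounded : ∀ u v → edges u v ≢ ∅ → u < suc B × v < suc B
      bounded u v nonempty with adjacent nonempty
      ... | inj₁ (onU , onV , _) = s≤s (onChain⇒≤ onU) , s≤s (onChain⇒≤ onV)
      ... | inj₂ (onV , onU , _) = s≤s (onChain⇒≤ onU) , s≤s (onChain⇒≤ onV)

    module Dynamics (σ : ℕ → Alph 0) (β : Alph 0)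
                    (last-label : ∀ t → c t ≡ true → depth (suc t) ≡ chainLength → σ t ≡ β)
                    (nonempty : 0 < chainLength)
                    {f r} (run : IsRun (machine σ) table f r) (start-idle : state (f 0) ≡ idle) where

      open RunOf {M = machine σ} {T = table} {f} {r} run

      K : ℕ
      K = chainLength

      node-asked : ∀ t n → asked (incoming (suc t) n) ≡ true →
                   r (suc t) (suc n) ≡ relaying (fromMaybe (σ t) (answerIn (incoming (suc t) n)))
      node-asked t n a = trans (run-step (suc t) n) (respond-asked {σ t} {incoming (suc t) n} a)

      node-unasked : ∀ t n → asked (incoming (suc t) n) ≡ false → r (suc t) (suc n) ≡ silent
      node-unasked t n a = trans (run-step (suc t) n) (respond-unasked {σ t} {incoming (suc t) n} a)

      asked-from : ∀ {u v n} → IsNext u v → asked (incoming v n) ≡ asked (cols (r u n))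
      asked-from next = incoming-from (next⇒query-edge next) λ edge → previous-unique (query-edge edge) next

      unasked : ∀ {v n} → (∀ u → ¬ IsNext u v) → asked (incoming v n) ≡ false
      unasked none = incoming-none λ u edge → none u (query-edge edge)

      answer-from : ∀ {v w n} → IsNext v w → answerIn (incoming v n) ≡ answerIn (cols (r w n))
      answer-from next = cong₂ answer (reply next) (reply next)
        where
        reply : ∀ {v w n i} → IsNext v w → lookup (incoming v n) (suc i) ≡ lookup (cols (r w n)) (suc i)
        reply next = incoming-from (next⇒answer-edge next) λ edge → next-unique (answer-edge edge) next

      answer-received : ∀ {v w n β} → IsNext v w → r w n ≡ relaying β → answerIn (incoming v n) ≡ just β
      answer-received {β = β} next eq =
        trans (answer-from next) (trans (cong (λ x → answerIn (cols x)) eq) (answerIn-relaying β))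

      no-answer : ∀ {v n} → (∀ w → ¬ IsNext v w) → answerIn (incoming v n) ≡ nothing
      no-answer none = cong₂ answer (nothing-from none) (nothing-from none)
        where
        nothing-from : ∀ {v n i} → (∀ w → ¬ IsNext v w) → lookup (incoming v n) (suc i) ≡ false
        nothing-from none = incoming-none λ w edge → none w (answer-edge edge)

      off-chain-silent : ∀ {t} → c t ≡ false → ∀ n → r (suc t) (suc n) ≡ silent
      off-chain-silent {t} off n = node-unasked t n (unasked λ u (_ , on , _) → contradiction (trans (sym on) off) λ ())

      root-first : r 0 1 ≡ table root (incoming 0 0) (disp (f 0)) idle
      root-first = trans (run-step 0 0)
        (cong₂ (table root _) (cong disp (run-start 0)) (trans (cong state (run-start 0)) start-idle))

      root-next : ∀ {n x} → r 0 n ≡ x → r 0 (suc n) ≡ table root (incoming 0 n) (disp x) (state x)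
      root-next {n} eq = trans (run-step 0 n) (cong (λ y → table root _ (disp y) (state y)) eq)

      module Silent (quiet : disp (f 0) ≡ 𝟘) where

        root-silent : ∀ n → r 0 (suc n) ≡ silent
        root-silent zero    = trans root-first (cong (λ z → table root _ z idle) quiet)
        root-silent (suc n) = root-next (root-silent n)

        silent-after : ∀ n {v} → OnChain v → depth v ≤ n → r v (suc n) ≡ silent
        silent-after n       {zero}  _  _  = root-silent n
        silent-after zero    {suc t} on d≤ = contradiction d≤ (<⇒≱ (positive-depth on))
        silent-after (suc n) {suc t} on d≤ with predecessor on
        ... | u , next@(onU , _ , d≡) = node-unasked t (suc n) (trans (asked-from next)
              (cong (λ x → asked (cols x)) (silent-after n onU (≤-pred (subst (_≤ suc n) d≡ d≤)))))

        settles : ∀ n → K ≤ n → ∀ v → r v (suc n) ≡ silent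
        settles n K≤n zero = root-silent n
        settles n K≤n (suc t) with c t in on
        ... | true  = silent-after n on (≤-trans (depth≤chainLength (suc t)) K≤n)
        ... | false = off-chain-silent on n

      catch-up : ∀ {n d} → d ≤ K → K + K ≤ n + d → d ≤ n
      catch-up {n} {d} d≤K h = ≤-trans d≤K (+-cancelʳ-≤ K K n (≤-trans h (+-monoʳ-≤ n d≤K)))

      module Asking (ask : disp (f 0) ≡ 𝟙) where

        root-asking : ∀ n → ∃ λ z → r 0 (suc n) ≡ asking z
        root-asking zero    = 𝟙 , trans root-first (cong (λ z → table root _ z idle) ask)
        root-asking (suc n) with root-asking n
        ... | z , eq = fromMaybe z (answerIn (incoming 0 (suc n))) , root-next eq

        query-arrived : ∀ {n t} → c t ≡ true → depth (suc t) ≤ n → asked (incoming (suc t) n) ≡ true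
        query-arrived {zero}  on d≤ = contradiction d≤ (<⇒≱ (positive-depth on))
        query-arrived {suc n} on d≤ with predecessor on
        ... | u , next@(onU , _ , d≡) = trans (asked-from next) (sends-query u onU (≤-pred (subst (_≤ suc n) d≡ d≤)))
          where
          sends-query : ∀ u → OnChain u → depth u ≤ n → asked (cols (r u (suc n))) ≡ true
          sends-query zero     _   _   = cong (λ x → asked (cols x)) (proj₂ (root-asking n))
          sends-query (suc t′) on′ d≤′ =
            cong (λ x → asked (cols x)) (node-asked t′ n (query-arrived on′ d≤′))

        relays : ∀ {n t} → c t ≡ true → depth (suc t) ≤ n →
                 r (suc t) (suc n) ≡ relaying (fromMaybe (σ t) (answerIn (incoming (suc t) n)))
        relays {n} {t} on d≤ = node-asked t n (query-arrived on d≤)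

        -- A vertex at depth d receives the query at time d and relays the final answer from
        -- time 2K − d + 1 on.
        answered : ∀ n {t} → c t ≡ true → K + K ≤ n + depth (suc t) → r (suc t) (suc n) ≡ relaying β
        answered zero        on h = contradiction (catch-up (depth≤chainLength _) h) (<⇒≱ (positive-depth on))
        answered (suc n) {t} on h = trans (relays on (catch-up (depth≤chainLength _) h)) (cong relaying reply)
          where
          reply : fromMaybe (σ t) (answerIn (incoming (suc t) (suc n))) ≡ β
          reply with m≤n⇒m<n∨m≡n (depth≤chainLength (suc t))
          ... | inj₂ last = trans (cong (fromMaybe (σ t)) (no-answer λ w → last-has-no-next last)) (last-label t on last)
          ... | inj₁ d<K with successor on d<K
          ...   | zero , (_ , _ , ())
          ...   | suc t′ , next@(_ , on′ , d≡) = cong (fromMaybe (σ t)) (answer-received next (answered n on′ h′))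
            where
            h′ : K + K ≤ n + depth (suc t′)
            h′ = subst (K + K ≤_) (trans (sym (+-suc n _)) (cong (n +_) (sym d≡))) h

        root-answered : ∀ n → K + K ≤ n → r 0 (suc n) ≡ asking β
        root-answered zero    h = contradiction (m+n≤o⇒m≤o K h) (<⇒≱ nonempty)
        root-answered (suc n) h with successor {0} tt nonempty | root-asking n
        ... | zero , (_ , _ , ()) | _
        ... | suc t , next@(_ , on , d≡) | z , eq =
          trans (root-next eq) (cong (λ a → asking (fromMaybe z a)) (answer-received next (answered n on h′)))
          where
          h′ : K + K ≤ n + depth (suc t)
          h′ = subst (K + K ≤_) (trans (+-comm 1 n) (cong (n +_) (sym d≡))) h

        answeredConfig : ℕ → Cell 3 0 2
        answeredConfig zero    = asking β
        answeredConfig (suc t) = if c t then relaying β else silent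

        settles : ∀ n → K + K ≤ n → ∀ v → r v (suc n) ≡ answeredConfig v
        settles n h zero = root-answered n h
        settles n h (suc t) with c t in on
        ... | true  = answered n on (≤-trans h (m≤m+n n _))
        ... | false = off-chain-silent on n

        answeredConfig-nodes : ∀ v → v ≢ 0 → disp (answeredConfig v) ≡ 𝟘
        answeredConfig-nodes zero    v≢0 = contradiction refl v≢0
        answeredConfig-nodes (suc t) _ with c t
        ... | true  = refl
        ... | false = refl

      haltingTime : ℕ
      haltingTime = suc (K + K)

      halts : HaltsAt r haltingTime
      halts with disp (f 0) in d
      ... | zero     = eventually-constant⇒HaltsAt {r = r} λ n K+K≤n →
                         Silent.settles d n (≤-trans (m≤m+n K K) K+K≤n)
      ... | suc zero = eventually-constant⇒HaltsAt {r = r} (Asking.settles d)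

      silent-outcome : disp (f 0) ≡ 𝟘 → ∀ v → disp (r v haltingTime) ≡ 𝟘
      silent-outcome quiet v = cong disp (Silent.settles quiet (K + K) (m≤m+n K K) v)

      asking-outcome : disp (f 0) ≡ 𝟙 →
                       disp (r 0 haltingTime) ≡ β × (∀ v → v ≢ 0 → disp (r v haltingTime) ≡ 𝟘)
      asking-outcome ask = cong disp (settles (K + K) ≤-refl 0)
                         , λ v v≢0 → trans (cong disp (settles (K + K) ≤-refl v)) (answeredConfig-nodes v v≢0)
        where open Asking ask

-- Counting the chain vertices

module Counting {e} (total : Total01 e) where

  open Chain (changed e)
  open Changes (≡-dec _≟_) (approx e)

  value : ℕ → ℕ
  value n = proj₁ (total n)

  value-unique : ∀ {n y} → Φ⟨ e ⟩ n ↓ y → y ≡ value n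
  value-unique φ = Φ-deterministic φ (proj₁ (proj₂ (total _)))

  changePointsBelow : ℕ → List ℕ
  changePointsBelow zero = []
  changePointsBelow (suc j) with value j ≟ value (suc j)
  ... | yes _ = changePointsBelow j
  ... | no  _ = j ∷ changePointsBelow j

  changePointsBelow-bounded : ∀ j → All (_< j) (changePointsBelow j)
  changePointsBelow-bounded zero = []
  changePointsBelow-bounded (suc j) with value j ≟ value (suc j)
  ... | yes _ = All.map m<n⇒m<1+n (changePointsBelow-bounded j)
  ... | no  _ = n<1+n j ∷ All.map m<n⇒m<1+n (changePointsBelow-bounded j)

  changePointsBelow-unique : ∀ j → Unique (changePointsBelow j)
  changePointsBelow-unique zero = []
  changePointsBelow-unique (suc j) with value j ≟ value (suc j)
  ... | yes _ = changePointsBelow-unique j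
  ... | no  _ = All.map >⇒≢ (changePointsBelow-bounded j) ∷ changePointsBelow-unique j

  changePointsBelow-changes : ∀ j → All (ChangePoint e) (changePointsBelow j)
  changePointsBelow-changes zero = []
  changePointsBelow-changes (suc j) with value j ≟ value (suc j)
  ... | yes _   = changePointsBelow-changes j
  ... | no  ≢ = (value j , value (suc j) , proj₁ (proj₂ (total j)) , proj₁ (proj₂ (total (suc j))) , ≢)
              ∷ changePointsBelow-changes j

  changesBelow : ℕ → ℕ
  changesBelow j = length (changePointsBelow j)

  changesBelow<k : ∀ {k} → FewerChangesThan e k → ∀ j → changesBelow j < k
  changesBelow<k fewer j = fewer _ (changePointsBelow-unique j) (changePointsBelow-changes j)

  changesBelow-≤-suc : ∀ j → changesBelow j ≤ changesBelow (suc j)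
  changesBelow-≤-suc j with value j ≟ value (suc j)
  ... | yes _ = ≤-refl
  ... | no  _ = n≤1+n _

  changesBelow-mono : ∀ {j j′} → j ≤ j′ → changesBelow j ≤ changesBelow j′
  changesBelow-mono {j′ = zero}  z≤n = ≤-refl
  changesBelow-mono {j′ = suc i} j≤ with m≤n⇒m<n∨m≡n j≤
  ... | inj₁ (s≤s j≤i) = ≤-trans (changesBelow-mono j≤i) (changesBelow-≤-suc i)
  ... | inj₂ refl      = ≤-refl

  changesBelow-strict : ∀ {j j′} → j ≤ j′ → value j ≢ value j′ → changesBelow j < changesBelow j′
  changesBelow-strict {j′ = zero}  z≤n ≢ = contradiction refl ≢
  changesBelow-strict {j′ = suc i} j≤ ≢ with m≤n⇒m<n∨m≡n j≤
  ... | inj₂ refl      = contradiction refl ≢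
  ... | inj₁ (s≤s j≤i) with value i ≟ value (suc i)
  ...   | yes ≡ = changesBelow-strict j≤i λ eq → ≢ (trans eq ≡)
  ...   | no  _ = s≤s (changesBelow-mono j≤i)

  latest-value : ∀ {t j y} → latest e t t ≡ just (j , y) → y ≡ value j
  latest-value {t} {j} eq = value-unique (evalWithin-sound e j t (proj₂ (latest-sound e t t eq)))

  frontier : ℕ → ℕ
  frontier t with latest e t t
  ... | nothing      = 0
  ... | just (j , _) = suc (changesBelow j)

  frontier-just : ∀ {t j y} → latest e t t ≡ just (j , y) → frontier t ≡ suc (changesBelow j)
  frontier-just {t} eq with latest e t t
  frontier-just refl | just _ = refl

  frontier-positive : ∀ t → approx e (suc t) ≢ nothing → 0 < frontier t
  frontier-positive t defined with latest e t t
  ... | nothing = contradiction refl defined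
  ... | just _  = s≤s z≤n

  frontier-mono : ∀ t → frontier t ≤ frontier (suc t)
  frontier-mono t with latest e t t in eq
  ... | nothing      = z≤n
  ... | just (j , y) with latest-step e t eq
  ...   | j′ , y′ , eq′ , j≤j′ = subst (_ ≤_) (sym (frontier-just {suc t} eq′)) (s≤s (changesBelow-mono j≤j′))

  frontier-strict : ∀ t → approx e (suc (suc t)) ≢ approx e (suc t) → frontier t < frontier (suc t)
  frontier-strict t differ with latest e t t in eq
  ... | nothing      = frontier-positive (suc t) differ
  ... | just (j , y) with latest-step e t eq
  ...   | j′ , y′ , eq′ , j≤j′ =
    subst (_ <_) (sym (frontier-just {suc t} eq′)) (s≤s (changesBelow-strict j≤j′ λ values≡ →
      differ (trans (cong (Maybe.map proj₂) eq′) (cong just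
        (trans (latest-value {suc t} eq′) (trans (sym values≡) (sym (latest-value {t} eq))))))))

  depth≤frontier : ∀ t → depth (suc t) ≤ frontier t
  depth≤frontier zero    = depth-suc-≤ {0} z≤n λ ch → frontier-positive 0 (changesAt-true {0} ch)
  depth≤frontier (suc t) = depth-suc-≤ {suc t} (≤-trans ih (frontier-mono t))
                                       λ ch → ≤-<-trans ih (frontier-strict t (changesAt-true {suc t} ch))
    where
    ih : depth (suc t) ≤ frontier t
    ih = depth≤frontier t

  depth≤k : ∀ {k} → FewerChangesThan e k → ∀ n → depth n ≤ k
  depth≤k fewer zero = z≤n
  depth≤k fewer (suc t) with latest e t t | depth≤frontier t
  ... | nothing      | ≤0 = ≤-trans ≤0 z≤n
  ... | just (j , _) | ≤f = ≤-trans ≤f (changesBelow<k fewer j)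

symbol : ℕ → ℕ → Alph 0
symbol e t = maybe′ bitSym 𝟘 (approx e (suc t))

chainMachine : ℕ → GM 3 3 2
chainMachine e = Chain.machine (changed e) (symbol e)

module Convergent {e m} (total : Total01 e) (limit : LimitIs e m) where

  open Chain (changed e) public
  open Changes (≡-dec _≟_) (approx e)

  S : ℕ
  S = proj₁ (approx-eventually limit)

  settled : ∀ t → S ≤ t → changed e t ≡ false
  settled = eventually-constant⇒quiet (proj₂ (approx-eventually limit))

  open Settled settled public

  nonempty : 0 < chainLength
  nonempty with approx-changes (proj₁ (proj₂ (total 0)))
  ... | t , on = positive-length {t} on

  last-label : ∀ t → changed e t ≡ true → depth (suc t) ≡ chainLength → symbol e t ≡ bitSym m
  last-label t on last = cong (maybe′ bitSym 𝟘) (begin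
    approx e (suc t)     ≡⟨ sym (constant-after (quiet-after-last {suc t} on last) (suc t + S) (m≤m+n _ _)) ⟩
    approx e (suc t + S) ≡⟨ proj₂ (approx-eventually limit) _ (m≤n+m S (suc t)) ⟩
    just m               ∎)
    where open ≡-Reasoning

halting-time-bound : ∀ {K k} → K ≤ k → suc (K + K) ≤ 2 * k + 4
halting-time-bound {K} {k} K≤k = begin
  suc (K + K)  ≤⟨ s≤s (+-mono-≤ K≤k K≤k) ⟩
  suc (k + k)  ≡⟨ cong (λ x → suc (k + x)) (sym (+-identityʳ k)) ⟩
  suc (2 * k)  ≡⟨ +-comm 1 (2 * k) ⟩
  2 * k + 1    ≤⟨ +-monoʳ-≤ (2 * k) (s≤s z≤n) ⟩
  2 * k + 4    ∎
  where open ≤-Reasoning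

mainTheorem16 :
    Σ ℕ λ nL → Σ ℕ λ nC → Σ ℕ λ a → Σ ℕ λ nS →
    Σ (Table nL nC a nS) λ T →
    Σ (ℕ → GM nL nC nS) λ M →
      (∀ e → IsGraphMachine (M e) T)
    × (∀ e → Total01 e → ∀ m → LimitIs e m →
          (FinitelyManyEdges (M e) × DegreeAtMost3 (M e))
        × (∀ f → Valid (M e) f → (∀ v → state (f v) ≡ s (M e)) →
             ∀ r → IsRun (M e) T f r →
                 (disp (f 0) ≡ 𝟘 →
                    Σ ℕ λ n → HaltsAt r n × (∀ v → disp (r v n) ≡ 𝟘))
               × (disp (f 0) ≡ 𝟙 →
                    Σ ℕ λ n → HaltsAt r n × disp (r 0 n) ≡ bitSym m
                            × (∀ v → v ≢ 0 → disp (r v n) ≡ 𝟘)))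
        × (∀ k → FewerChangesThan e k → ∀ f → Starting (M e) f →
             ∀ r → IsRun (M e) T f r →
               Σ ℕ λ n → n ≤ 2 * k + 4 × HaltsAt r n))
mainTheorem16 =
  3 , 3 , 0 , 2 , table , chainMachine , (λ e → Chain.machine-isGraphMachine (changed e) (symbol e)) ,
  λ e total m limit → let open Convergent total limit in
      (finitely-many-edges (symbol e) , degree≤3 (symbol e))
    , (λ f _ initial r run → let open Dynamics (symbol e) (bitSym m) last-label nonempty run (initial 0) in
          (λ quiet → haltingTime , halts , silent-outcome quiet)
        , (λ ask → haltingTime , halts , asking-outcome ask))
    , (λ k fewer f (start , _) r run →
          let open Dynamics (symbol e) (bitSym m) last-label nonempty run (proj₂ (start 0)) in
          haltingTime , halting-time-bound (Counting.depth≤k total fewer S) , halts)
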